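{- Let $j\in\mathbb{N}$ and $x=\langle d,k,m\rangle\in M_n\setminus\{\mathbf{0}\}$. There exists $y\in M_n$ with $y^j=x$ if and only if $d$ is an integer multiple of $j$. In that case such $y$ is unique in $M_n$, and $y=\langle d',k',m'\rangle\in M_n\setminus\{\mathbf{0}\}$ with $$d'=\frac{d}{j},\qquad k'=k+(j-1)\min(0,d'),\qquad m'=m+(j-1)\max(0,d').$$
   Context: Fix an integer $n\ge 2$. For integers $d,k,m$ with $1-\min(0,d)\le k\le m\le n-\max(0,d)$, let $\langle d,k,m\rangle$ denote the $n\times n$ matrix with entries $x_{ij}$ ($i,j\in\{1,\dots,n\}$) equal to $1$ if $k\le i\le m$ and $j-i=d$, and $0$ otherwise. Let $\mathbf{0}$ be the $n\times n$ zero matrix and $M_n=\{\mathbf{0}\}\cup\{\langle d,k,m\rangle: d\in\mathbb{Z},\ k,m\in\mathbb{N},\ 1-\min(0,d)\le k\le m\le n-\max(0,d)\}$, a monoid under matrix multiplication. -}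

module Defs where

open import Data.Nat as ℕ using (ℕ; zero; suc)
open import Data.Integer as ℤ using (ℤ; +_; _+_; _-_; _*_; _≤_; _≤?_; _≟_)
open import Data.Fin using (Fin; toℕ) renaming (zero to fzero; suc to fsuc)
open import Data.Bool using (Bool; true; false; if_then_else_; _∧_)
open import Data.Product using (Σ; ∃; _×_)
open import Data.Sum using (_⊎_)
open import Relation.Nullary.Decidable using (⌊_⌋)
open import Relation.Binary.PropositionalEquality using (_≡_)

-- n × n matrices with natural-number entries, indices Fin n (row/column i ↦ toℕ i + 1)
Mat : ℕ → Set
Mat n = Fin n → Fin n → ℕ

sumFin : ∀ {n} → (Fin n → ℕ) → ℕ
sumFin {zero}  f = 0
sumFin {suc n} f = f fzero ℕ.+ sumFin (λ i → f (fsuc i))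

_⊗_ : ∀ {n} → Mat n → Mat n → Mat n
(A ⊗ B) i j = sumFin (λ l → A i l ℕ.* B l j)

𝟙 : ∀ {n} → Mat n
𝟙 i j = if ⌊ toℕ i ℕ.≟ toℕ j ⌋ then 1 else 0

𝟘 : ∀ {n} → Mat n
𝟘 i j = 0

pow : ∀ {n} → Mat n → ℕ → Mat n
pow y zero    = 𝟙
pow y (suc j) = y ⊗ pow y j

_≈_ : ∀ {n} → Mat n → Mat n → Set
A ≈ B = ∀ i j → A i j ≡ B i j

idx : ∀ {n} → Fin n → ℤ
idx i = + suc (toℕ i)

⟨_,_,_⟩ : ∀ {n} → ℤ → ℤ → ℤ → Mat n
⟨ d , k , m ⟩ i j =
  if ⌊ k ≤? idx i ⌋ ∧ ⌊ idx i ≤? m ⌋ ∧ ⌊ idx j - idx i ≟ d ⌋ then 1 else 0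

Valid : ℕ → ℤ → ℤ → ℤ → Set
Valid n d k m = (+ 1 - (+ 0 ℤ.⊓ d) ≤ k) × (k ≤ m) × (m ≤ + n - (+ 0 ℤ.⊔ d))

InM : (n : ℕ) → Mat n → Set
InM n y = (y ≈ 𝟘) ⊎ (Σ ℤ λ d → Σ ℤ λ k → Σ ℤ λ m → Valid n d k m × (y ≈ ⟨ d , k , m ⟩))

-- Row x of the band ⟨ e , a , b ⟩ vanishes outside [a, b] and is the unit vector at column x + e
-- inside it, so a band times a band is a band, and by induction the (t+1)-st power of ⟨ e , a , b ⟩
-- is the band with offset (t+1)e on the rows [a - t min(0,e), b - t max(0,e)]. A nonempty band
-- determines its parameters through its first and last entries, and powers of 𝟘 are 𝟘. So a j-th
-- root of ⟨ d , k , m ⟩ is a band whose offset d' satisfies j d' = d and whose rows are recovered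
-- from the power formula; conversely those parameters form a valid band with j-th power ⟨ d , k , m ⟩.
module Submission where

open import Defs
open import Data.Nat as ℕ using (ℕ; zero; suc; _≥_; z≤n)
import Data.Nat.Properties as ℕP
open import Data.Integer as ℤ using (ℤ; +_; _+_; _-_; _*_; _⊓_; _⊔_; _≤_; +≤+; _≤?_; _≟_)
import Data.Integer.Properties as ℤP
open import Data.Integer.Divisibility using (_∣_)
import Data.Integer.Divisibility.Signed as Signed
open import Data.Integer.Tactic.RingSolver using (solve; solve-∀)
open import Algebra.Bundles using (AbelianGroup)
open import Algebra.Properties.Group (AbelianGroup.group ℤP.+-0-abelianGroup) using (∙-cancelˡ)
open import Data.Fin using (Fin; toℕ; fromℕ<) renaming (zero to fzero; suc to fsuc)
open import Data.Fin.Properties using (toℕ-injective; toℕ-fromℕ<; suc-injective)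
open import Data.Bool using (if_then_else_; _∧_)
open import Data.Empty using (⊥; ⊥-elim)
open import Data.List using (_∷_; [])
open import Data.Product using (Σ; _×_; _,_; proj₁; proj₂)
open import Data.Sum using (inj₁; inj₂)
open import Function.Bundles using (_⇔_; mk⇔; Equivalence)
open import Relation.Nullary using (¬_; Dec; yes; no; does; _×-dec_; contradiction)
open import Relation.Nullary.Decidable using (dec-true; dec-false; map′; isYes≗does)
open import Relation.Binary.PropositionalEquality using (_≡_; _≢_; refl; sym; trans; cong; cong₂; subst)

open Equivalence using (to; from)

-- Linear inequalities i ≤ j are proved by writing j - i as a visibly nonnegative term g;
-- the identity g ≡ j - i is left to the ring solver.
≤-by-gap : ∀ {i j} g → + 0 ≤ g → g ≡ j - i → i ≤ j
≤-by-gap _ 0≤g refl = ℤP.0≤i-j⇒j≤i 0≤g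

0≤i+j : ∀ {i j} → + 0 ≤ i → + 0 ≤ j → + 0 ≤ i + j
0≤i+j = ℤP.+-mono-≤

0≤i*j : ∀ {i j} → + 0 ≤ i → + 0 ≤ j → + 0 ≤ i * j
0≤i*j {+ m} {+ n} _ _ = subst (+ 0 ≤_) (ℤP.pos-* m n) (+≤+ z≤n)

0≤+ : ∀ t → + 0 ≤ + t
0≤+ t = +≤+ z≤n

0≤1+ : ∀ {i} → + 0 ≤ i → + 0 ≤ + 1 + i
0≤1+ = 0≤i+j (0≤+ 1)

gap : ∀ {i j} → i ≤ j → + 0 ≤ j - i
gap = ℤP.i≤j⇒0≤j-i

i-j+j≡i : ∀ i j → i - j + j ≡ i
i-j+j≡i = solve-∀

i+j-j≡i : ∀ i j → i + j - j ≡ i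
i+j-j≡i = solve-∀

i+j-i≡j : ∀ i j → i + j - i ≡ j
i+j-i≡j = solve-∀

j+[i-j]≡i : ∀ i j → j + (i - j) ≡ i
j+[i-j]≡i = solve-∀

by-sign : ∀ {ℓ} e (P : ℤ → ℤ → Set ℓ) → (+ 0 ≤ e → P (+ 0) e) → (e ≤ + 0 → P e (+ 0)) →
  P (+ 0 ⊓ e) (+ 0 ⊔ e)
by-sign e P nonneg nonpos with ℤP.≤-total (+ 0) e
... | inj₁ 0≤e rewrite ℤP.i≤j⇒i⊓j≡i 0≤e | ℤP.i≤j⇒i⊔j≡j 0≤e = nonneg 0≤e
... | inj₂ e≤0 rewrite ℤP.i≥j⇒i⊓j≡j e≤0 | ℤP.i≥j⇒i⊔j≡i e≤0 = nonpos e≤0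

sumFin-cong : ∀ {n} {f g : Fin n → ℕ} → (∀ l → f l ≡ g l) → sumFin f ≡ sumFin g
sumFin-cong {zero}  f≡g = refl
sumFin-cong {suc n} f≡g = cong₂ ℕ._+_ (f≡g fzero) (sumFin-cong (λ l → f≡g (fsuc l)))

sumFin-zero : ∀ {n} {f : Fin n → ℕ} → (∀ l → f l ≡ 0) → sumFin f ≡ 0
sumFin-zero {zero}  f≡0 = refl
sumFin-zero {suc n} f≡0 = cong₂ ℕ._+_ (f≡0 fzero) (sumFin-zero (λ l → f≡0 (fsuc l)))

sumFin-single : ∀ {n} {f : Fin n → ℕ} (l₀ : Fin n) → (∀ l → l ≢ l₀ → f l ≡ 0) → sumFin f ≡ f l₀
sumFin-single {suc n} {f} fzero f≡0 =
  trans (cong (f fzero ℕ.+_) (sumFin-zero (λ l → f≡0 (fsuc l) (λ ())))) (ℕP.+-identityʳ _)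
sumFin-single {suc n} {f} (fsuc l₀) f≡0 =
  trans (cong (ℕ._+ sumFin (λ l → f (fsuc l))) (f≡0 fzero (λ ())))
        (sumFin-single l₀ (λ l l≢l₀ → f≡0 (fsuc l) (λ e → l≢l₀ (suc-injective e))))

⊗-congˡ : ∀ {n} {A A′ B : Mat n} → A ≈ A′ → (A ⊗ B) ≈ (A′ ⊗ B)
⊗-congˡ {B = B} A≈A′ i j = sumFin-cong (λ l → cong (ℕ._* B l j) (A≈A′ i l))

⊗-congʳ : ∀ {n} {A B B′ : Mat n} → B ≈ B′ → (A ⊗ B) ≈ (A ⊗ B′)
⊗-congʳ {A = A} B≈B′ i j = sumFin-cong (λ l → cong (A i l ℕ.*_) (B≈B′ l j))

pow-cong : ∀ {n} {A A′ : Mat n} → A ≈ A′ → ∀ t → pow A t ≈ pow A′ t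
pow-cong A≈A′ zero    i j = refl
pow-cong {A = A} {A′} A≈A′ (suc t) i j =
  trans (⊗-congˡ {B = pow A t} A≈A′ i j) (⊗-congʳ {A = A′} (pow-cong A≈A′ t) i j)

⊗-unit-row : ∀ {n} {A B : Mat n} {i l₀ : Fin n} → (∀ l → l ≢ l₀ → A i l ≡ 0) → A i l₀ ≡ 1 →
  ∀ j → (A ⊗ B) i j ≡ B l₀ j
⊗-unit-row {A = A} {B} {i} {l₀} off on j =
  trans (sumFin-single l₀ (λ l l≢l₀ → cong (ℕ._* B l j) (off l l≢l₀)))
        (trans (cong (ℕ._* B l₀ j) on) (ℕP.*-identityˡ (B l₀ j)))

⊗-zero-row : ∀ {n} {A B : Mat n} {i : Fin n} → (∀ l → A i l ≡ 0) → ∀ j → (A ⊗ B) i j ≡ 0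
⊗-zero-row {B = B} A≡0 j = sumFin-zero (λ l → cong (ℕ._* B l j) (A≡0 l))

⊗-identityʳ : ∀ {n} {A : Mat n} → (A ⊗ 𝟙) ≈ A
⊗-identityʳ {A = A} i j =
  trans (sumFin-single j (λ l l≢j → trans (cong (A i l ℕ.*_) (𝟙-off l≢j)) (ℕP.*-zeroʳ (A i l))))
        (trans (cong (A i j ℕ.*_) 𝟙-on) (ℕP.*-identityʳ (A i j)))
  where
  𝟙-off : ∀ {l} → l ≢ j → 𝟙 l j ≡ 0
  𝟙-off {l} l≢j with toℕ l ℕ.≟ toℕ j
  ... | yes e = contradiction (toℕ-injective e) l≢j
  ... | no _  = refl
  𝟙-on : 𝟙 j j ≡ 1
  𝟙-on with toℕ j ℕ.≟ toℕ j
  ... | yes _  = refl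
  ... | no j≢j = contradiction refl j≢j

pow-𝟘 : ∀ {n} t → pow {n} 𝟘 (suc t) ≈ 𝟘
pow-𝟘 {n} t i = ⊗-zero-row {A = 𝟘} {B = pow 𝟘 t} {i = i} (λ l → refl)

InGrid : ℕ → ℤ → Set
InGrid n x = + 1 ≤ x × x ≤ + n

idx-onto : ∀ {n x} → InGrid n x → Σ (Fin n) λ i → idx i ≡ x
idx-onto {x = + zero}  (+≤+ () , _)
idx-onto {x = + suc p} (_ , +≤+ p<n) = fromℕ< p<n , cong (λ v → + suc v) (toℕ-fromℕ< p<n)

idx-injective : ∀ {n} {i l : Fin n} → idx i ≡ idx l → i ≡ l
idx-injective e = toℕ-injective (ℕP.suc-injective (ℤP.+-injective e))

Band : ℤ → ℤ → ℤ → ℤ → ℤ → Set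
Band d k m x y = k ≤ x × x ≤ m × y ≡ x + d

band? : ∀ d k m x y → Dec (Band d k m x y)
band? d k m x y =
  k ≤? x ×-dec x ≤? m ×-dec
  map′ (λ e → trans (sym (j+[i-j]≡i y x)) (cong (λ v → x + v) e)) (λ { refl → i+j-i≡j x d }) (y - x ≟ d)

⟨⟩-entry : ∀ {n} d k m (i j : Fin n) →
  ⟨ d , k , m ⟩ i j ≡ (if does (band? d k m (idx i) (idx j)) then 1 else 0)
⟨⟩-entry d k m i j = cong (λ c → if c then 1 else 0)
  (cong₂ _∧_ (isYes≗does (k ≤? idx i))
             (cong₂ _∧_ (isYes≗does (idx i ≤? m)) (isYes≗does (idx j - idx i ≟ d))))

⟨⟩-one : ∀ {n} d k m (i j : Fin n) → Band d k m (idx i) (idx j) → ⟨ d , k , m ⟩ i j ≡ 1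
⟨⟩-one d k m i j b =
  trans (⟨⟩-entry d k m i j)
        (cong (λ c → if c then 1 else 0) (dec-true (band? d k m (idx i) (idx j)) b))

⟨⟩-zero : ∀ {n} d k m (i j : Fin n) → ¬ Band d k m (idx i) (idx j) → ⟨ d , k , m ⟩ i j ≡ 0
⟨⟩-zero d k m i j ¬b =
  trans (⟨⟩-entry d k m i j)
        (cong (λ c → if c then 1 else 0) (dec-false (band? d k m (idx i) (idx j)) ¬b))

⟨⟩-one⇒Band : ∀ {n} d k m (i j : Fin n) → ⟨ d , k , m ⟩ i j ≡ 1 → Band d k m (idx i) (idx j)
⟨⟩-one⇒Band d k m i j e with band? d k m (idx i) (idx j)
... | yes b = b
... | no ¬b = contradiction (trans (sym (⟨⟩-zero d k m i j ¬b)) e) (λ ())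

⟨⟩-cong-Band : ∀ {n d k m d′ k′ m′} {i j i′ j′ : Fin n} →
  (Band d k m (idx i) (idx j) → Band d′ k′ m′ (idx i′) (idx j′)) →
  (Band d′ k′ m′ (idx i′) (idx j′) → Band d k m (idx i) (idx j)) →
  ⟨ d , k , m ⟩ i j ≡ ⟨ d′ , k′ , m′ ⟩ i′ j′
⟨⟩-cong-Band {d = d} {k} {m} {d′} {k′} {m′} {i} {j} {i′} {j′} f g with band? d k m (idx i) (idx j)
... | yes b = trans (⟨⟩-one d k m i j b) (sym (⟨⟩-one d′ k′ m′ i′ j′ (f b)))
... | no ¬b = trans (⟨⟩-zero d k m i j ¬b) (sym (⟨⟩-zero d′ k′ m′ i′ j′ (λ b′ → ¬b (g b′))))

⟨⟩-cong : ∀ {n d k m d′ k′ m′} → d ≡ d′ → k ≡ k′ → m ≡ m′ → ⟨_,_,_⟩ {n} d k m ≈ ⟨ d′ , k′ , m′ ⟩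
⟨⟩-cong refl refl refl i j = refl

-- Valid with the sign cases resolved: the first entry (k, k + d) and the last entry (m, m + d)
-- lie in the N × N grid. Without k ≤ m it survives taking powers, which may empty the band.
Fits : ℤ → ℤ → ℤ → ℤ → Set
Fits N d k m = (+ 1 ≤ k × + 1 ≤ k + d) × (m ≤ N × m + d ≤ N)

bounds⇔Fits : ∀ {N d k m} → (+ 1 - (+ 0 ⊓ d) ≤ k × m ≤ N - (+ 0 ⊔ d)) ⇔ Fits N d k m
bounds⇔Fits {N} {d} {k} {m} = mk⇔ bounds⇒Fits Fits⇒bounds
  where
  bounds⇒Fits : + 1 - (+ 0 ⊓ d) ≤ k × m ≤ N - (+ 0 ⊔ d) → Fits N d k m
  bounds⇒Fits = by-sign d (λ lo hi → + 1 - lo ≤ k × m ≤ N - hi → Fits N d k m)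
    (λ 0≤d (lo , hi) →
      ( ≤-by-gap (k - (+ 1 - + 0)) (gap lo) (solve (k ∷ []))
      , ≤-by-gap (k - (+ 1 - + 0) + d) (0≤i+j (gap lo) 0≤d) (solve (k ∷ d ∷ [])) ) ,
      ( ≤-by-gap (N - d - m + d) (0≤i+j (gap hi) 0≤d) (solve (N ∷ d ∷ m ∷ []))
      , ≤-by-gap (N - d - m) (gap hi) (solve (N ∷ d ∷ m ∷ [])) ))
    (λ d≤0 (lo , hi) →
      ( ≤-by-gap (k - (+ 1 - d) + (+ 0 - d)) (0≤i+j (gap lo) (gap d≤0)) (solve (k ∷ d ∷ []))
      , ≤-by-gap (k - (+ 1 - d)) (gap lo) (solve (k ∷ d ∷ [])) ) ,
      ( ≤-by-gap (N - + 0 - m) (gap hi) (solve (N ∷ m ∷ []))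
      , ≤-by-gap (N - + 0 - m + (+ 0 - d)) (0≤i+j (gap hi) (gap d≤0)) (solve (N ∷ d ∷ m ∷ [])) ))
  Fits⇒bounds : Fits N d k m → + 1 - (+ 0 ⊓ d) ≤ k × m ≤ N - (+ 0 ⊔ d)
  Fits⇒bounds = by-sign d (λ lo hi → Fits N d k m → + 1 - lo ≤ k × m ≤ N - hi)
    (λ _ ((1≤k , _) , (_ , m+d≤N)) →
      ≤-by-gap (k - + 1) (gap 1≤k) (solve (k ∷ [])) ,
      ≤-by-gap (N - (m + d)) (gap m+d≤N) (solve (N ∷ d ∷ m ∷ [])))
    (λ _ ((_ , 1≤k+d) , (m≤N , _)) →
      ≤-by-gap (k + d - + 1) (gap 1≤k+d) (solve (k ∷ d ∷ [])) ,
      ≤-by-gap (N - m) (gap m≤N) (solve (N ∷ m ∷ [])))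

Valid⇒Fits : ∀ {n d k m} → Valid n d k m → Fits (+ n) d k m
Valid⇒Fits (lo , _ , hi) = to bounds⇔Fits (lo , hi)

Fits⇒Valid : ∀ {n d k m} → k ≤ m → Fits (+ n) d k m → Valid n d k m
Fits⇒Valid k≤m fits = let (lo , hi) = from bounds⇔Fits fits in lo , k≤m , hi

Band-inGrid : ∀ {n d k m x y} → Fits (+ n) d k m → Band d k m x y → InGrid n x × InGrid n y
Band-inGrid {d = d} ((1≤k , 1≤k+d) , (m≤n , m+d≤n)) (k≤x , x≤m , refl) =
  (ℤP.≤-trans 1≤k k≤x , ℤP.≤-trans x≤m m≤n) ,
  (ℤP.≤-trans 1≤k+d (ℤP.+-monoˡ-≤ d k≤x) , ℤP.≤-trans (ℤP.+-monoˡ-≤ d x≤m) m+d≤n)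

⊗-⟨⟩ : ∀ {n e a b d K M K′ M′} → Fits (+ n) e a b →
  (∀ {x} → (a ≤ x × K ≤ x + e) ⇔ K′ ≤ x) →
  (∀ {x} → (x ≤ b × x + e ≤ M) ⇔ x ≤ M′) →
  (⟨ e , a , b ⟩ ⊗ ⟨ d , K , M ⟩) ≈ ⟨_,_,_⟩ {n} (e + d) K′ M′
⊗-⟨⟩ {n} {e} {a} {b} {d} {K} {M} {K′} {M′} fits lower upper i j with a ≤? idx i ×-dec idx i ≤? b
... | yes (a≤x , x≤b) =
  trans (⊗-unit-row {A = ⟨ e , a , b ⟩} {B = ⟨ d , K , M ⟩} off on j) (⟨⟩-cong-Band shift unshift)
  where
  x = idx i
  column : Σ (Fin n) λ l → idx l ≡ x + e
  column = idx-onto (proj₂ (Band-inGrid fits (a≤x , x≤b , refl)))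
  l₀ = proj₁ column
  off : ∀ l → l ≢ l₀ → ⟨ e , a , b ⟩ i l ≡ 0
  off l l≢l₀ =
    ⟨⟩-zero e a b i l (λ (_ , _ , l≡) → l≢l₀ (idx-injective (trans l≡ (sym (proj₂ column)))))
  on : ⟨ e , a , b ⟩ i l₀ ≡ 1
  on = ⟨⟩-one e a b i l₀ (a≤x , x≤b , proj₂ column)
  shift : Band d K M (idx l₀) (idx j) → Band (e + d) K′ M′ x (idx j)
  shift rewrite proj₂ column = λ (K≤ , ≤M , j≡) →
    to lower (a≤x , K≤) , to upper (x≤b , ≤M) , trans j≡ (ℤP.+-assoc x e d)
  unshift : Band (e + d) K′ M′ x (idx j) → Band d K M (idx l₀) (idx j)
  unshift rewrite proj₂ column = λ (K′≤ , ≤M′ , j≡) →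
    proj₂ (from lower K′≤) , proj₂ (from upper ≤M′) , trans j≡ (sym (ℤP.+-assoc x e d))
... | no x∉[a,b] =
  trans (⊗-zero-row {A = ⟨ e , a , b ⟩} {B = ⟨ d , K , M ⟩} {i = i}
                    (λ l → ⟨⟩-zero e a b i l (λ (a≤x , x≤b , _) → x∉[a,b] (a≤x , x≤b))) j)
        (sym (⟨⟩-zero (e + d) K′ M′ i j
                (λ (K′≤x , x≤M′ , _) → x∉[a,b] (proj₁ (from lower K′≤x) , proj₁ (from upper x≤M′)))))

lower-step : ∀ {T e a x} → + 0 ≤ T →
  (a ≤ x × a - T * (+ 0 ⊓ e) ≤ x + e) ⇔ a - (+ 1 + T) * (+ 0 ⊓ e) ≤ x
lower-step {T} {e} {a} {x} 0≤T = mk⇔ merge split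
  where
  merge : a ≤ x × a - T * (+ 0 ⊓ e) ≤ x + e → a - (+ 1 + T) * (+ 0 ⊓ e) ≤ x
  merge (a≤x , q) = by-sign e (λ lo _ → a - T * lo ≤ x + e → a - (+ 1 + T) * lo ≤ x)
    (λ _ _ → ≤-by-gap (x - a) (gap a≤x) (solve (T ∷ a ∷ x ∷ [])))
    (λ _ q → ≤-by-gap (x + e - (a - T * e)) (gap q) (solve (T ∷ e ∷ a ∷ x ∷ [])))
    q
  split : a - (+ 1 + T) * (+ 0 ⊓ e) ≤ x → a ≤ x × a - T * (+ 0 ⊓ e) ≤ x + e
  split = by-sign e (λ lo _ → a - (+ 1 + T) * lo ≤ x → a ≤ x × a - T * lo ≤ x + e)
    (λ 0≤e p → ≤-by-gap (x - (a - (+ 1 + T) * + 0)) (gap p) (solve (T ∷ a ∷ x ∷ [])) ,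
               ≤-by-gap (x - (a - (+ 1 + T) * + 0) + e) (0≤i+j (gap p) 0≤e) (solve (T ∷ e ∷ a ∷ x ∷ [])))
    (λ e≤0 p → ≤-by-gap (x - (a - (+ 1 + T) * e) + (+ 1 + T) * (+ 0 - e))
                        (0≤i+j (gap p) (0≤i*j (0≤1+ 0≤T) (gap e≤0))) (solve (T ∷ e ∷ a ∷ x ∷ [])) ,
               ≤-by-gap (x - (a - (+ 1 + T) * e)) (gap p) (solve (T ∷ e ∷ a ∷ x ∷ [])))

upper-step : ∀ {T e b x} → + 0 ≤ T →
  (x ≤ b × x + e ≤ b - T * (+ 0 ⊔ e)) ⇔ x ≤ b - (+ 1 + T) * (+ 0 ⊔ e)
upper-step {T} {e} {b} {x} 0≤T = mk⇔ merge split
  where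
  merge : x ≤ b × x + e ≤ b - T * (+ 0 ⊔ e) → x ≤ b - (+ 1 + T) * (+ 0 ⊔ e)
  merge (x≤b , q) = by-sign e (λ _ hi → x + e ≤ b - T * hi → x ≤ b - (+ 1 + T) * hi)
    (λ _ q → ≤-by-gap (b - T * e - (x + e)) (gap q) (solve (T ∷ e ∷ b ∷ x ∷ [])))
    (λ _ _ → ≤-by-gap (b - x) (gap x≤b) (solve (T ∷ b ∷ x ∷ [])))
    q
  split : x ≤ b - (+ 1 + T) * (+ 0 ⊔ e) → x ≤ b × x + e ≤ b - T * (+ 0 ⊔ e)
  split = by-sign e (λ _ hi → x ≤ b - (+ 1 + T) * hi → x ≤ b × x + e ≤ b - T * hi)
    (λ 0≤e p → ≤-by-gap (b - (+ 1 + T) * e - x + (+ 1 + T) * e)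
                        (0≤i+j (gap p) (0≤i*j (0≤1+ 0≤T) 0≤e)) (solve (T ∷ e ∷ b ∷ x ∷ [])) ,
               ≤-by-gap (b - (+ 1 + T) * e - x) (gap p) (solve (T ∷ e ∷ b ∷ x ∷ [])))
    (λ e≤0 p → ≤-by-gap (b - (+ 1 + T) * + 0 - x) (gap p) (solve (T ∷ b ∷ x ∷ [])) ,
               ≤-by-gap (b - (+ 1 + T) * + 0 - x + (+ 0 - e)) (0≤i+j (gap p) (gap e≤0))
                        (solve (T ∷ e ∷ b ∷ x ∷ [])))

pow-⟨⟩ : ∀ {n e a b} → Fits (+ n) e a b → ∀ t →
  pow (⟨_,_,_⟩ {n} e a b) (suc t) ≈ ⟨ + suc t * e , a - + t * (+ 0 ⊓ e) , b - + t * (+ 0 ⊔ e) ⟩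
pow-⟨⟩ {n} {e} {a} {b} fits zero i j =
  trans (⊗-identityʳ {A = ⟨ e , a , b ⟩} i j)
        (⟨⟩-cong {n} {e} {a} {b}
                 (sym (ℤP.*-identityˡ e)) (sym (ℤP.+-identityʳ a)) (sym (ℤP.+-identityʳ b)) i j)
pow-⟨⟩ {n} {e} {a} {b} fits (suc t) i j =
  trans (⊗-congʳ {A = ⟨ e , a , b ⟩} (pow-⟨⟩ fits t) i j)
        (trans (⊗-⟨⟩ fits (lower-step (0≤+ t)) (upper-step (0≤+ t)) i j)
               (⟨⟩-cong {n} {k = a - + suc t * (+ 0 ⊓ e)} {m = b - + suc t * (+ 0 ⊔ e)}
                         (sym (ℤP.suc-* (+ suc t) e)) refl refl i j))

pow-Fits : ∀ {N T e a b} → + 0 ≤ T → Fits N e a b →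
  Fits N ((+ 1 + T) * e) (a - T * (+ 0 ⊓ e)) (b - T * (+ 0 ⊔ e))
pow-Fits {N} {T} {e} {a} {b} 0≤T ((1≤a , 1≤a+e) , (b≤N , b+e≤N)) =
  by-sign e (λ lo hi → Fits N ((+ 1 + T) * e) (a - T * lo) (b - T * hi))
    (λ 0≤e →
      ( ≤-by-gap (a - + 1) (gap 1≤a) (solve (T ∷ a ∷ []))
      , ≤-by-gap (a + e - + 1 + T * e) (0≤i+j (gap 1≤a+e) (0≤i*j 0≤T 0≤e)) (solve (T ∷ e ∷ a ∷ [])) ) ,
      ( ≤-by-gap (N - (b + e) + (+ 1 + T) * e) (0≤i+j (gap b+e≤N) (0≤i*j (0≤1+ 0≤T) 0≤e))
                 (solve (N ∷ T ∷ e ∷ b ∷ []))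
      , ≤-by-gap (N - (b + e)) (gap b+e≤N) (solve (N ∷ T ∷ e ∷ b ∷ [])) ))
    (λ e≤0 →
      ( ≤-by-gap (a + e - + 1 + (+ 1 + T) * (+ 0 - e)) (0≤i+j (gap 1≤a+e) (0≤i*j (0≤1+ 0≤T) (gap e≤0)))
                 (solve (T ∷ e ∷ a ∷ []))
      , ≤-by-gap (a + e - + 1) (gap 1≤a+e) (solve (T ∷ e ∷ a ∷ [])) ) ,
      ( ≤-by-gap (N - b) (gap b≤N) (solve (N ∷ T ∷ b ∷ []))
      , ≤-by-gap (N - b + (+ 1 + T) * (+ 0 - e)) (0≤i+j (gap b≤N) (0≤i*j (0≤1+ 0≤T) (gap e≤0)))
                 (solve (N ∷ T ∷ e ∷ b ∷ [])) ))

≈⇒Band : ∀ {n d k m d′ k′ m′ x y} → ⟨_,_,_⟩ {n} d k m ≈ ⟨ d′ , k′ , m′ ⟩ → Fits (+ n) d k m →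
  Band d k m x y → Band d′ k′ m′ x y
≈⇒Band {d = d} {k} {m} {d′} {k′} {m′} eq fits b with Band-inGrid fits b
... | x∈ , y∈ with idx-onto x∈ | idx-onto y∈
... | i , refl | j , refl = ⟨⟩-one⇒Band d′ k′ m′ i j (trans (sym (eq i j)) (⟨⟩-one d k m i j b))

⟨⟩-injective : ∀ {n d₁ k₁ m₁ d k m} → Fits (+ n) d₁ k₁ m₁ → k ≤ m → Fits (+ n) d k m →
  ⟨_,_,_⟩ {n} d₁ k₁ m₁ ≈ ⟨ d , k , m ⟩ → d₁ ≡ d × k₁ ≡ k × m₁ ≡ m
⟨⟩-injective {n} {d₁} {k₁} {m₁} {d} {k} {m} fits₁ k≤m fits eq =
  d₁≡d ,
  ℤP.≤-antisym (proj₁ first) (proj₁ first₁) ,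
  ℤP.≤-antisym (proj₁ (proj₂ last₁)) (proj₁ (proj₂ last))
  where
  eq⁻¹ : ⟨_,_,_⟩ {n} d k m ≈ ⟨ d₁ , k₁ , m₁ ⟩
  eq⁻¹ i j = sym (eq i j)
  first : Band d₁ k₁ m₁ k (k + d)
  first = ≈⇒Band eq⁻¹ fits (ℤP.≤-refl , k≤m , refl)
  last : Band d₁ k₁ m₁ m (m + d)
  last = ≈⇒Band eq⁻¹ fits (k≤m , ℤP.≤-refl , refl)
  d₁≡d : d₁ ≡ d
  d₁≡d = sym (∙-cancelˡ k d d₁ (proj₂ (proj₂ first)))
  k₁≤m₁ : k₁ ≤ m₁
  k₁≤m₁ = ℤP.≤-trans (proj₁ first) (proj₁ (proj₂ first))
  first₁ : Band d k m k₁ (k₁ + d₁)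
  first₁ = ≈⇒Band eq fits₁ (ℤP.≤-refl , k₁≤m₁ , refl)
  last₁ : Band d k m m₁ (m₁ + d₁)
  last₁ = ≈⇒Band eq fits₁ (k₁≤m₁ , ℤP.≤-refl , refl)

⟨⟩≉𝟘 : ∀ {n d k m} → k ≤ m → Fits (+ n) d k m → ¬ (⟨_,_,_⟩ {n} d k m ≈ 𝟘)
⟨⟩≉𝟘 {n} {d} {k} {m} k≤m fits eq = no-entry (ℤP.≤-refl , k≤m , refl)
  where
  no-entry : ∀ {x y} → Band d k m x y → ⊥
  no-entry b with Band-inGrid fits b
  ... | x∈ , y∈ with idx-onto x∈ | idx-onto y∈
  ... | i , refl | j , refl = contradiction (trans (sym (⟨⟩-one d k m i j b)) (eq i j)) (λ ())

root-Fits : ∀ {N T d k m} → Fits N ((+ 1 + T) * d) k m →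
  Fits N d (k + T * (+ 0 ⊓ d)) (m + T * (+ 0 ⊔ d))
root-Fits {N} {T} {d} {k} {m} ((1≤k , 1≤k+D) , (m≤N , m+D≤N)) =
  by-sign d (λ lo hi → Fits N d (k + T * lo) (m + T * hi))
    (λ 0≤d →
      ( ≤-by-gap (k - + 1) (gap 1≤k) (solve (T ∷ k ∷ []))
      , ≤-by-gap (k - + 1 + d) (0≤i+j (gap 1≤k) 0≤d) (solve (T ∷ d ∷ k ∷ [])) ) ,
      ( ≤-by-gap (N - (m + (+ 1 + T) * d) + d) (0≤i+j (gap m+D≤N) 0≤d) (solve (N ∷ T ∷ d ∷ m ∷ []))
      , ≤-by-gap (N - (m + (+ 1 + T) * d)) (gap m+D≤N) (solve (N ∷ T ∷ d ∷ m ∷ [])) ))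
    (λ d≤0 →
      ( ≤-by-gap (k + (+ 1 + T) * d - + 1 + (+ 0 - d)) (0≤i+j (gap 1≤k+D) (gap d≤0))
                 (solve (T ∷ d ∷ k ∷ []))
      , ≤-by-gap (k + (+ 1 + T) * d - + 1) (gap 1≤k+D) (solve (T ∷ d ∷ k ∷ [])) ) ,
      ( ≤-by-gap (N - m) (gap m≤N) (solve (N ∷ T ∷ m ∷ []))
      , ≤-by-gap (N - m + (+ 0 - d)) (0≤i+j (gap m≤N) (gap d≤0)) (solve (N ∷ T ∷ d ∷ m ∷ [])) ))

root-valid : ∀ {n d k m} t d′ → d ≡ + suc t * d′ → Valid n d k m →
  Valid n d′ (k + + t * (+ 0 ⊓ d′)) (m + + t * (+ 0 ⊔ d′))
root-valid t d′ refl V@(_ , k≤m , _) =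
  Fits⇒Valid (ℤP.+-mono-≤ k≤m (ℤP.*-monoˡ-≤-nonNeg (+ t) (ℤP.i⊓j≤i⊔j (+ 0) d′)))
             (root-Fits {T = + t} (Valid⇒Fits V))

root-pow : ∀ {n d k m} t d′ → d ≡ + suc t * d′ → Valid n d k m →
  pow (⟨_,_,_⟩ {n} d′ (k + + t * (+ 0 ⊓ d′)) (m + + t * (+ 0 ⊔ d′))) (suc t) ≈ ⟨ d , k , m ⟩
root-pow {n} {d} {k} {m} t d′ refl V i j =
  trans (pow-⟨⟩ (Valid⇒Fits (root-valid t d′ refl V)) t i j)
        (⟨⟩-cong {n} {+ suc t * d′} refl
                 (i+j-j≡i k (+ t * (+ 0 ⊓ d′))) (i+j-j≡i m (+ t * (+ 0 ⊔ d′))) i j)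

root-exists : ∀ {n d k m} t d′ → d ≡ + suc t * d′ → Valid n d k m →
  Σ (Mat n) λ y → InM n y × pow y (suc t) ≈ ⟨ d , k , m ⟩
root-exists t d′ d≡ V =
  _ , inj₂ (d′ , _ , _ , root-valid t d′ d≡ V , λ i j → refl) , root-pow t d′ d≡ V

root-is-band : ∀ {n d k m y} t → Valid n d k m → InM n y → pow y (suc t) ≈ ⟨ d , k , m ⟩ →
  Σ ℤ λ e → Σ ℤ λ a → Σ ℤ λ b →
    y ≈ ⟨ e , a , b ⟩ × + suc t * e ≡ d × a - + t * (+ 0 ⊓ e) ≡ k × b - + t * (+ 0 ⊔ e) ≡ m
root-is-band t V@(_ , k≤m , _) (inj₁ y≈𝟘) yʲ≈ =
  ⊥-elim (⟨⟩≉𝟘 k≤m (Valid⇒Fits V)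
    (λ i j → trans (sym (yʲ≈ i j)) (trans (pow-cong y≈𝟘 (suc t) i j) (pow-𝟘 t i j))))
root-is-band t V@(_ , k≤m , _) (inj₂ (e , a , b , Vy , y≈)) yʲ≈ =
  e , a , b , y≈ , ⟨⟩-injective (pow-Fits (0≤+ t) (Valid⇒Fits Vy)) k≤m (Valid⇒Fits V)
    (λ i j → trans (sym (pow-⟨⟩ (Valid⇒Fits Vy) t i j))
                   (trans (sym (pow-cong y≈ (suc t) i j)) (yʲ≈ i j)))

root-divides : ∀ {n d k m y} t → Valid n d k m → InM n y → pow y (suc t) ≈ ⟨ d , k , m ⟩ →
  + suc t ∣ d
root-divides t V y∈M yʲ≈ with root-is-band t V y∈M yʲ≈
... | e , _ , _ , _ , d≡ , _ = Signed.∣⇒∣ᵤ (Signed.divides e (trans (sym d≡) (ℤP.*-comm (+ suc t) e)))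

root-unique : ∀ {n d k m y} t d′ → d ≡ + suc t * d′ → Valid n d k m → InM n y →
  pow y (suc t) ≈ ⟨ d , k , m ⟩ → y ≈ ⟨ d′ , k + + t * (+ 0 ⊓ d′) , m + + t * (+ 0 ⊔ d′) ⟩
root-unique t d′ refl V y∈M yʲ≈ with root-is-band t V y∈M yʲ≈
... | e , a , b , y≈ , d≡ , refl , refl with ℤP.*-cancelˡ-≡ (+ suc t) e d′ d≡
... | refl = λ i j → trans (y≈ i j) (⟨⟩-cong refl (sym (i-j+j≡i a _)) (sym (i-j+j≡i b _)) i j)

theorem6 : (n : ℕ) → n ≥ 2 → (j : ℕ) → j ≥ 1 → (d k m : ℤ) → Valid n d k m →
    ((Σ (Mat n) λ y → InM n y × (pow y j ≈ ⟨ d , k , m ⟩)) ⇔ ((+ j) ∣ d))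
    × ((d' : ℤ) → d ≡ + j * d' →
        let k' = k + (+ j - + 1) * (+ 0 ⊓ d')
            m' = m + (+ j - + 1) * (+ 0 ⊔ d')
        in Valid n d' k' m'
           × (pow {n} ⟨ d' , k' , m' ⟩ j ≈ ⟨ d , k , m ⟩)
           × ((y : Mat n) → InM n y → pow y j ≈ ⟨ d , k , m ⟩ → y ≈ ⟨ d' , k' , m' ⟩))
theorem6 n _ zero () d k m V
theorem6 n _ (suc t) _ d k m V =
  mk⇔ (λ (y , y∈M , yʲ≈) → root-divides t V y∈M yʲ≈) ∣⇒root ,
  λ d′ d≡ → root-valid t d′ d≡ V , root-pow t d′ d≡ V , λ y → root-unique t d′ d≡ V
  where
  ∣⇒root : + suc t ∣ d → Σ (Mat n) λ y → InM n y × pow y (suc t) ≈ ⟨ d , k , m ⟩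
  ∣⇒root j∣d with Signed.∣ᵤ⇒∣ j∣d
  ... | Signed.divides d′ d≡d′*j = root-exists t d′ (trans d≡d′*j (ℤP.*-comm d′ (+ suc t))) V
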